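{- Let $G \ne K_4$ be a connected, claw-free, cubic graph of order $n$ with $n_3$ triangle-units and $n_4$ diamond-units. Then (a) $Z(G) \le n_3 + n_4 + 2$, and (b) $Z(G) \le \frac{1}{3}n + 2$.
   Context: All graphs are finite and simple. A graph is cubic if every vertex has degree $3$, and claw-free if it contains no induced subgraph isomorphic to $K_{1,3}$. A triangle is a subgraph isomorphic to $K_3$; a diamond is a graph isomorphic to $K_4$ with one edge removed. It is known that if $G\ne K_4$ is a connected, claw-free, cubic graph, then $V(G)$ can be uniquely partitioned into sets each of which induces a triangle or a diamond in $G$; the parts inducing a triangle are called triangle-units and the parts inducing a diamond are called diamond-units, and $n_3$, $n_4$ denote their respective numbers. Zero forcing: given a set $S\subseteq V(G)$ of initially colored vertices (all others uncolored), repeatedly apply the rule: if a colored vertex has exactly one uncolored neighbor, that neighbor becomes colored. $S$ is a zero forcing set if iterating this rule eventually colors all of $V(G)$. $Z(G)$ is the minimum cardinality of a zero forcing set of $G$. -}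

module Defs where

open import Data.Nat using (ℕ; zero; suc; _+_; _*_; _≤_)
open import Data.Fin using (Fin)
open import Data.Fin.Properties using (_≟_)
open import Data.Fin.Subset using (Subset; ∣_∣)
open import Data.Vec using (Vec; lookup; tabulate)
open import Data.Bool using (Bool; true; false)
open import Data.Product using (Σ; _×_; ∃; ∃-syntax; _,_)
open import Data.Sum using (_⊎_)
open import Relation.Nullary using (¬_; does)
open import Relation.Binary.PropositionalEquality using (_≡_; _≢_)

record Graph (n : ℕ) : Set where
  field
    adj   : Fin n → Fin n → Bool
    sym   : ∀ u v → adj u v ≡ adj v u
    irrefl : ∀ v → adj v v ≡ false
open Graph public

module _ {n : ℕ} (G : Graph n) where

  Adj : Fin n → Fin n → Set
  Adj u v = adj G u v ≡ true

  N : Fin n → Subset n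
  N v = tabulate (adj G v)

  degree : Fin n → ℕ
  degree v = ∣ N v ∣

  Cubic : Set
  Cubic = ∀ v → degree v ≡ 3

  data Reach : Fin n → Fin n → Set where
    here  : ∀ {v} → Reach v v
    step  : ∀ {u v w} → Adj u v → Reach v w → Reach u w

  Connected : Set
  Connected = ∀ u v → Reach u v

  ClawFree : Set
  ClawFree = ∀ v a b c → Adj v a → Adj v b → Adj v c →
             a ≢ b → b ≢ c → a ≢ c →
             Adj a b ⊎ Adj b c ⊎ Adj a c

  IsK4 : Set
  IsK4 = (n ≡ 4) × (∀ u v → u ≢ v → Adj u v)

  -- This inductive closure is exactly the final colouring.
  data Coloured (S : Subset n) : Fin n → Set where
    init  : ∀ {v} → lookup S v ≡ true → Coloured S v
    force : ∀ {u v} → Coloured S u → Adj u v →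
            (∀ w → Adj u w → w ≢ v → Coloured S w) → Coloured S v

  ZeroForcingSet : Subset n → Set
  ZeroForcingSet S = ∀ v → Coloured S v

  ZeroForcingNumber≤ : ℕ → Set
  ZeroForcingNumber≤ k = ∃[ S ] (ZeroForcingSet S × ∣ S ∣ ≤ k)

  InPart : ∀ {k} → (Fin n → Fin k) → Fin k → Fin n → Set
  InPart f i v = f v ≡ i

  part : ∀ {k} → (Fin n → Fin k) → Fin k → Subset n
  part f i = tabulate (λ v → does (f v ≟ i))

  InducesTriangle : Subset n → Set
  InducesTriangle P =
    (∣ P ∣ ≡ 3) ×
    (∀ u v → lookup P u ≡ true → lookup P v ≡ true → u ≢ v → Adj u v)

  InducesDiamond : Subset n → Set
  InducesDiamond P =
    (∣ P ∣ ≡ 4) ×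
    (∃[ a ] ∃[ b ] (lookup P a ≡ true × lookup P b ≡ true × a ≢ b ×
       adj G a b ≡ false ×
       (∀ u v → lookup P u ≡ true → lookup P v ≡ true → u ≢ v →
          adj G u v ≡ false → (u ≡ a × v ≡ b) ⊎ (u ≡ b × v ≡ a))))

data UnitKind : Set where
  triangle diamond : UnitKind

isTriangle : UnitKind → Bool
isTriangle triangle = true
isTriangle diamond  = false

isDiamond : UnitKind → Bool
isDiamond triangle = false
isDiamond diamond  = true

module _ {n : ℕ} (G : Graph n) where
  IsUnitPartition : ∀ {k} → (Fin n → Fin k) → (Fin k → UnitKind) → Set
  IsUnitPartition {k} f t = ∀ i → Kinded (t i) (part G f i)
    where
      Kinded : UnitKind → Subset n → Set
      Kinded triangle P = InducesTriangle G P
      Kinded diamond  P = InducesDiamond G P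

n₃ : ∀ {k} → (Fin k → UnitKind) → ℕ
n₃ t = ∣ tabulate (λ i → isTriangle (t i)) ∣

n₄ : ∀ {k} → (Fin k → UnitKind) → ℕ
n₄ t = ∣ tabulate (λ i → isDiamond (t i)) ∣

-- Colour the units one at a time. Three vertices of the first unit colour it. By connectivity
-- some edge xy leaves the coloured units; x and its two neighbours inside its unit are coloured,
-- so x forces y, and paying for one more vertex e₁ of y's unit colours the whole unit: in a
-- triangle y then forces the third vertex; a diamond is always entered at a tip (a centre has no
-- neighbour outside its unit), which forces the other centre, and that centre forces the other
-- tip. Hence Z(G) ≤ 3 + (k - 1) = n₃ + n₄ + 2 for the k = n₃ + n₄ units, and as every unit has
-- at least three vertices, 3k ≤ n turns this into 3 Z(G) ≤ n + 6.
module Submission where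

open import Defs hiding (sym)
open import Data.Bool using (true; false)
open import Data.Empty using (⊥-elim)
open import Data.Fin using (Fin; zero; suc; remQuot; combine)
open import Data.Fin.Properties using (_≟_; injective⇒≤; combine-remQuot)
open import Data.Fin.Subset using (Subset; ⊤; ⁅_⁆; ∣_∣; _∈_; _∉_; _⊆_; _-_; _∪_; inside; outside)
open import Data.Fin.Subset.Properties
  using (∈⊤; ∣⊤∣≡n; x∈⁅x⁆; ∣⁅x⁆∣≡1; p⊆q⇒∣p∣≤∣q∣; p⊆p∪q; q⊆p∪q; ∣p∣≤∣x∷p∣; p─q⊆p;
         x∈p∧x≢y⇒x∈p-y; x∈p⇒∣p-x∣<∣p∣)
open import Data.List as List using (List; []; _∷_; length)
open import Data.List.Membership.Propositional using () renaming (_∈_ to _∈ˡ_)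
open import Data.List.Membership.Propositional.Properties using (∈-lookup)
open import Data.List.Relation.Unary.All as All using (All; []; _∷_)
open import Data.List.Relation.Unary.All.Properties using (¬Any⇒All¬; All¬⇒¬Any)
open import Data.List.Relation.Unary.AllPairs using ([]; _∷_)
open import Data.List.Relation.Unary.Any using (here; there; any?)
open import Data.List.Relation.Unary.Unique.Propositional using (Unique)
open import Data.Nat using (ℕ; zero; suc; _+_; _*_; _≤_; _<_; _≤?_; z≤n; s≤s; s≤s⁻¹; z<s; s<s)
open import Data.Nat.Properties
  using (module ≤-Reasoning; ≤-reflexive; ≤-trans; n≤1+n; 1+n≰n; ≰⇒>; +-suc; +-identityʳ;
         +-monoˡ-≤; +-monoʳ-≤; *-comm; *-monoʳ-≤; *-distribˡ-+)
open import Data.Product using (∃; ∃₂; ∃-syntax; _×_; _,_; proj₁; proj₂; uncurry)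
open import Data.Sum as Sum using (_⊎_; inj₁; inj₂)
open import Data.Vec using ([]; _∷_; here; there)
open import Data.Vec.Properties using ([]=⇒lookup; lookup⇒[]=; lookup∘tabulate)
open import Function using (_∘_)
open import Function.Definitions using (Injective)
open import Relation.Binary.PropositionalEquality
  using (_≡_; _≢_; refl; sym; trans; cong; subst; ≢-sym; module ≡-Reasoning)
open import Relation.Nullary using (¬_; yes; no; does)
open import Relation.Nullary.Decidable using (dec-true)
open import Relation.Unary using (Pred; Decidable)

private
  variable
    n : ℕ

x∉p-x : ∀ {x : Fin n} (p : Subset n) → x ∉ p - x
x∉p-x {x = zero}  (s ∷ p) ()
x∉p-x {x = suc x} (s ∷ p) (there x∈p-x) = x∉p-x p x∈p-x

∣p∪q∣≤∣p∣+∣q∣ : ∀ (p q : Subset n) → ∣ p ∪ q ∣ ≤ ∣ p ∣ + ∣ q ∣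
∣p∪q∣≤∣p∣+∣q∣ []            []            = z≤n
∣p∪q∣≤∣p∣+∣q∣ (inside  ∷ p) (s ∷ q)       =
  s≤s (≤-trans (∣p∪q∣≤∣p∣+∣q∣ p q) (+-monoʳ-≤ ∣ p ∣ (∣p∣≤∣x∷p∣ s q)))
∣p∪q∣≤∣p∣+∣q∣ (outside ∷ p) (inside  ∷ q) rewrite +-suc ∣ p ∣ ∣ q ∣ = s≤s (∣p∪q∣≤∣p∣+∣q∣ p q)
∣p∪q∣≤∣p∣+∣q∣ (outside ∷ p) (outside ∷ q) = ∣p∪q∣≤∣p∣+∣q∣ p q

∣⁅x⁆∪p∣≤1+∣p∣ : ∀ x (p : Subset n) → ∣ ⁅ x ⁆ ∪ p ∣ ≤ suc ∣ p ∣
∣⁅x⁆∪p∣≤1+∣p∣ x p =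
  subst (λ m → ∣ ⁅ x ⁆ ∪ p ∣ ≤ m + ∣ p ∣) (∣⁅x⁆∣≡1 x) (∣p∪q∣≤∣p∣+∣q∣ ⁅ x ⁆ p)

∣p∣≤1+∣p-x∣ : ∀ (p : Subset n) x → ∣ p ∣ ≤ suc ∣ p - x ∣
∣p∣≤1+∣p-x∣ p x = ≤-trans (p⊆q⇒∣p∣≤∣q∣ p⊆x∪p-x) (∣⁅x⁆∪p∣≤1+∣p∣ x (p - x))
  where
  p⊆x∪p-x : p ⊆ ⁅ x ⁆ ∪ (p - x)
  p⊆x∪p-x {y} y∈p with y ≟ x
  ... | yes refl = p⊆p∪q (p - x) (x∈⁅x⁆ x)
  ... | no  y≢x  = q⊆p∪q ⁅ x ⁆ (p - x) (x∈p∧x≢y⇒x∈p-y y∈p y≢x)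

Unique⇒length≤∣p∣ : ∀ {p : Subset n} {xs} → Unique xs → All (_∈ p) xs →
                    length xs ≤ ∣ p ∣
Unique⇒length≤∣p∣ []           []            = z≤n
Unique⇒length≤∣p∣ (x≢xs ∷ xs!) (x∈p ∷ xs⊆p) =
  ≤-trans (s≤s (Unique⇒length≤∣p∣ xs! xs⊆p-x)) (x∈p⇒∣p-x∣<∣p∣ x∈p)
  where
  xs⊆p-x = All.zipWith (λ (y∈p , x≢y) → x∈p∧x≢y⇒x∈p-y y∈p (≢-sym x≢y)) (xs⊆p , x≢xs)

length<∣p∣⇒fresh : ∀ (p : Subset n) xs → length xs < ∣ p ∣ →
                   ∃ λ x → x ∈ p × All (x ≢_) xs
length<∣p∣⇒fresh (inside  ∷ p) []       _  = zero , here , []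
length<∣p∣⇒fresh (outside ∷ p) []       lt
  with x , x∈p , _ ← length<∣p∣⇒fresh p [] lt
  = suc x , there x∈p , []
length<∣p∣⇒fresh p             (y ∷ ys) lt
  with x , x∈p-y , x≢ys ←
         length<∣p∣⇒fresh (p - y) ys (s≤s⁻¹ (≤-trans lt (∣p∣≤1+∣p-x∣ p y)))
  = x , p─q⊆p p ⁅ y ⁆ x∈p-y , (λ { refl → x∉p-x p x∈p-y }) ∷ x≢ys

∣p∣≤length⇒∈ : ∀ {p : Subset n} {xs x} → Unique xs → All (_∈ p) xs → ∣ p ∣ ≤ length xs →
               x ∈ p → x ∈ˡ xs
∣p∣≤length⇒∈ {xs = xs} {x} xs! xs⊆p ∣p∣≤ x∈p with any? (x ≟_) xs
... | yes x∈xs = x∈xs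
... | no  x∉xs = ⊥-elim (1+n≰n (≤-trans x∷xs≤p ∣p∣≤))
  where x∷xs≤p = Unique⇒length≤∣p∣ (¬Any⇒All¬ xs x∉xs ∷ xs!) (x∈p ∷ xs⊆p)

lookup-injective : ∀ {a} {A : Set a} {xs : List A} → Unique xs →
                   Injective _≡_ _≡_ (List.lookup xs)
lookup-injective (_    ∷ _)   {zero}  {zero}  _  = refl
lookup-injective (x≢xs ∷ _)   {zero}  {suc j} eq = ⊥-elim (All.lookup x≢xs (∈-lookup j) eq)
lookup-injective (x≢xs ∷ _)   {suc i} {zero}  eq = ⊥-elim (All.lookup x≢xs (∈-lookup i) (sym eq))
lookup-injective (_    ∷ xs!) {suc i} {suc j} eq = cong suc (lookup-injective xs! eq)

fibres⇒*≤ : ∀ {n k m} (f : Fin n → Fin k) (g : Fin k → Fin m → Fin n) →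
            (∀ i j → f (g i j) ≡ i) → (∀ i → Injective _≡_ _≡_ (g i)) → k * m ≤ n
fibres⇒*≤ {k = k} {m = m} f g fg≡ g-injective = injective⇒≤ h-injective
  where
  ĝ-injective : ∀ {p q} → uncurry g p ≡ uncurry g q → p ≡ q
  ĝ-injective {i , j} {i′ , j′} eq
    with refl ← trans (sym (fg≡ i j)) (trans (cong f eq) (fg≡ i′ j′))
    with refl ← g-injective i eq
    = refl
  h-injective : Injective _≡_ _≡_ (uncurry g ∘ remQuot {k} m)
  h-injective {x} {y} eq = begin
    x                                  ≡⟨ combine-remQuot {k} m x ⟨
    uncurry combine (remQuot {k} m x)  ≡⟨ cong (uncurry combine) (ĝ-injective eq) ⟩
    uncurry combine (remQuot {k} m y)  ≡⟨ combine-remQuot {k} m y ⟩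
    y                                  ∎
    where open ≡-Reasoning

module _ {n : ℕ} (G : Graph n) where

  Adj-sym : ∀ {u v} → Adj G u v → Adj G v u
  Adj-sym {u} {v} uv = trans (Graph.sym G v u) uv

  Adj⇒≢ : ∀ {u v} → Adj G u v → u ≢ v
  Adj⇒≢ {u} uu refl with () ← trans (sym (Graph.irrefl G u)) uu

  Adj⇒∈N : ∀ {u v} → Adj G u v → v ∈ N G u
  Adj⇒∈N {u} {v} uv = lookup⇒[]= v (N G u) (trans (lookup∘tabulate (adj G u) v) uv)

  crossing-edge : ∀ {p} {P : Pred (Fin n) p} → Decidable P →
                  ∀ {u v} → Reach G u v → P u → ¬ P v → ∃₂ λ x y → Adj G x y × P x × ¬ P y
  crossing-edge P? here                Pu ¬Pv = ⊥-elim (¬Pv Pu)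
  crossing-edge P? (step {v = w} uw wv) Pu ¬Pv with P? w
  ... | yes Pw = crossing-edge P? wv Pw ¬Pv
  ... | no ¬Pw = _ , _ , uw , Pu , ¬Pw

  colour : ∀ {S v} → v ∈ S → Coloured G S v
  colour v∈S = init ([]=⇒lookup v∈S)

  Coloured-mono : ∀ {S T} → S ⊆ T → ∀ {v} → Coloured G S v → Coloured G T v
  Coloured-mono S⊆T (init v∈S)         = colour (S⊆T (lookup⇒[]= _ _ v∈S))
  Coloured-mono S⊆T (force Cu uv Cnbrs) =
    force (Coloured-mono S⊆T Cu) uv (λ w uw w≢v → Coloured-mono S⊆T (Cnbrs w uw w≢v))

  module _ (cubic : Cubic G) where

    cubic-neighbours : ∀ {x a b c w} → Adj G x a → Adj G x b → Adj G x c →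
                       a ≢ b → a ≢ c → b ≢ c → Adj G x w → w ∈ˡ a ∷ b ∷ c ∷ []
    cubic-neighbours xa xb xc a≢b a≢c b≢c xw =
      ∣p∣≤length⇒∈ ((a≢b ∷ a≢c ∷ []) ∷ (b≢c ∷ []) ∷ [] ∷ [])
                   (Adj⇒∈N xa ∷ Adj⇒∈N xb ∷ Adj⇒∈N xc ∷ [])
                   (≤-reflexive (cubic _)) (Adj⇒∈N xw)

    force-third : ∀ {S x a b c} → Adj G x a → Adj G x b → Adj G x c →
                  a ≢ b → a ≢ c → b ≢ c →
                  Coloured G S x → Coloured G S a → Coloured G S b → Coloured G S c
    force-third xa xb xc a≢b a≢c b≢c Cx Ca Cb = force Cx xc Cnbrs
      where
      Cnbrs : ∀ w → Adj G _ w → w ≢ _ → Coloured G _ w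
      Cnbrs w xw w≢c with cubic-neighbours xa xb xc a≢b a≢c b≢c xw
      ... | here refl                 = Ca
      ... | there (here refl)         = Cb
      ... | there (there (here refl)) = ⊥-elim (w≢c refl)

module Units {n : ℕ} (G : Graph n) (cubic : Cubic G) {k : ℕ} (f : Fin n → Fin k) where

  ∈-part⁺ : ∀ {v i} → f v ≡ i → v ∈ part G f i
  ∈-part⁺ {v} {i} fv≡i =
    lookup⇒[]= v _ (trans (lookup∘tabulate _ v) (dec-true (f v ≟ i) fv≡i))

  ∈-part⁻ : ∀ {v i} → v ∈ part G f i → f v ≡ i
  ∈-part⁻ {v} {i} v∈P
    with f v ≟ i | trans (sym (lookup∘tabulate (λ w → does (f w ≟ i)) v)) ([]=⇒lookup v∈P)
  ... | yes fv≡i | _ = fv≡i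
  ... | no  _    | ()

  ≢-across-units : ∀ {u v i} → f u ≡ i → f v ≢ i → u ≢ v
  ≢-across-units fu≡i fv≢i refl = fv≢i fu≡i

  Full : Subset n → Fin k → Set
  Full S i = ∀ v → f v ≡ i → Coloured G S v

  -- How unit i is coloured through its vertex y: entering from a coloured outside neighbour
  -- costs the single extra vertex e₁, while seed colours the first unit from y, e₁ and e₂.
  record Entry (i : Fin k) (y : Fin n) : Set where
    field
      e₁ e₂ : Fin n
      e₁≢e₂ : e₁ ≢ e₂
      f-e₁  : f e₁ ≡ i
      f-e₂  : f e₂ ≡ i
      y-e₁  : Adj G y e₁
      y-e₂  : Adj G y e₂
      enter : ∀ {S x} → Adj G y x → f x ≢ i →
              Coloured G S x → Coloured G S y → Coloured G S e₁ → Full S i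
      seed  : ∀ {S} → Coloured G S y → Coloured G S e₁ → Coloured G S e₂ → Full S i

  triangle-entry : ∀ {i} → InducesTriangle G (part G f i) → ∀ {y} → f y ≡ i → Entry i y
  triangle-entry {i} (∣P∣≡3 , P-adj) {y} fy≡i
    with s , s∈P , s≢y ∷ [] ←
           length<∣p∣⇒fresh (part G f i) (y ∷ []) (subst (1 <_) (sym ∣P∣≡3) (s<s z<s))
    with r , r∈P , r≢y ∷ r≢s ∷ [] ←
           length<∣p∣⇒fresh (part G f i) (y ∷ s ∷ []) (subst (2 <_) (sym ∣P∣≡3) (s<s (s<s z<s)))
    = record
      { e₁ = s ; e₂ = r ; e₁≢e₂ = ≢-sym r≢s ; f-e₁ = f-s ; f-e₂ = f-r
      ; y-e₁ = y-s ; y-e₂ = y-r ; enter = enter ; seed = fill }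
    where
    y∈P = ∈-part⁺ fy≡i
    f-s = ∈-part⁻ s∈P
    f-r = ∈-part⁻ r∈P
    y-s = P-adj y s ([]=⇒lookup y∈P) ([]=⇒lookup s∈P) (≢-sym s≢y)
    y-r = P-adj y r ([]=⇒lookup y∈P) ([]=⇒lookup r∈P) (≢-sym r≢y)
    fill : ∀ {S} → Coloured G S y → Coloured G S s → Coloured G S r → Full S i
    fill Cy Cs Cr v fv≡i
      with ∣p∣≤length⇒∈ ((≢-sym s≢y ∷ ≢-sym r≢y ∷ []) ∷ (≢-sym r≢s ∷ []) ∷ [] ∷ [])
                        (y∈P ∷ s∈P ∷ r∈P ∷ []) (≤-reflexive ∣P∣≡3) (∈-part⁺ fv≡i)
    ... | here refl                 = Cy
    ... | there (here refl)         = Cs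
    ... | there (there (here refl)) = Cr
    enter : ∀ {S x} → Adj G y x → f x ≢ i →
            Coloured G S x → Coloured G S y → Coloured G S s → Full S i
    enter y-x fx≢i Cx Cy Cs = fill Cy Cs Cr
      where
      Cr = force-third G cubic y-s y-x y-r (≢-across-units f-s fx≢i) (≢-sym r≢s)
                       (≢-sym (≢-across-units f-r fx≢i)) Cy Cs Cx

  -- a and b are the tips (the non-adjacent pair), c and d the centres.
  record Diamond (i : Fin k) : Set where
    field
      a b c d : Fin n
      f-a : f a ≡ i
      f-b : f b ≡ i
      f-c : f c ≡ i
      f-d : f d ≡ i
      a≢b : a ≢ b
      c-a : Adj G c a
      c-b : Adj G c b
      d-a : Adj G d a
      d-b : Adj G d b
      c-d : Adj G c d
      cover : ∀ v → f v ≡ i → (v ≡ a ⊎ v ≡ b) ⊎ (v ≡ c ⊎ v ≡ d)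

  swap-tips : ∀ {i} → Diamond i → Diamond i
  swap-tips D = record D
    { a = b ; b = a ; f-a = f-b ; f-b = f-a ; a≢b = ≢-sym a≢b
    ; c-a = c-b ; c-b = c-a ; d-a = d-b ; d-b = d-a
    ; cover = λ v fv≡i → Sum.map₁ Sum.swap (cover v fv≡i) }
    where open Diamond D

  swap-centres : ∀ {i} → Diamond i → Diamond i
  swap-centres D = record D
    { c = d ; d = c ; f-c = f-d ; f-d = f-c
    ; c-a = d-a ; c-b = d-b ; d-a = c-a ; d-b = c-b ; c-d = Adj-sym G c-d
    ; cover = λ v fv≡i → Sum.map₂ Sum.swap (cover v fv≡i) }
    where open Diamond D

  module _ {i : Fin k} (D : Diamond i) where
    open Diamond D

    fill : ∀ {S} → Coloured G S a → Coloured G S b → Coloured G S c → Coloured G S d →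
           Full S i
    fill Ca Cb Cc Cd v fv≡i with cover v fv≡i
    ... | inj₁ (inj₁ refl) = Ca
    ... | inj₁ (inj₂ refl) = Cb
    ... | inj₂ (inj₁ refl) = Cc
    ... | inj₂ (inj₂ refl) = Cd

    fill-from-acd : ∀ {S} → Coloured G S a → Coloured G S c → Coloured G S d → Full S i
    fill-from-acd Ca Cc Cd = fill Ca Cb Cc Cd
      where
      Cb = force-third G cubic c-a c-d c-b (≢-sym (Adj⇒≢ G d-a)) a≢b (Adj⇒≢ G d-b) Cc Ca Cd

    tip-entry : Entry i a
    tip-entry = record
      { e₁ = c ; e₂ = d ; e₁≢e₂ = Adj⇒≢ G c-d ; f-e₁ = f-c ; f-e₂ = f-d
      ; y-e₁ = Adj-sym G c-a ; y-e₂ = Adj-sym G d-a ; enter = enter ; seed = fill-from-acd }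
      where
      enter : ∀ {S x} → Adj G a x → f x ≢ i →
              Coloured G S x → Coloured G S a → Coloured G S c → Full S i
      enter a-x fx≢i Cx Ca Cc = fill-from-acd Ca Cc Cd
        where
        Cd = force-third G cubic (Adj-sym G c-a) a-x (Adj-sym G d-a) (≢-across-units f-c fx≢i)
                         (Adj⇒≢ G c-d) (≢-sym (≢-across-units f-d fx≢i)) Ca Cc Cx

    centre-entry : Entry i c
    centre-entry = record
      { e₁ = d ; e₂ = a ; e₁≢e₂ = Adj⇒≢ G d-a ; f-e₁ = f-d ; f-e₂ = f-a
      ; y-e₁ = c-d ; y-e₂ = c-a ; enter = enter ; seed = λ Cc Cd Ca → fill-from-acd Ca Cc Cd }
      where
      enter : ∀ {S x} → Adj G c x → f x ≢ i →
              Coloured G S x → Coloured G S c → Coloured G S d → Full S i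
      enter c-x fx≢i _ _ _ = ⊥-elim (fx≢i (All.lookup (f-a ∷ f-b ∷ f-d ∷ []) x∈abd))
        where
        x∈abd = cubic-neighbours G cubic c-a c-b c-d a≢b (≢-sym (Adj⇒≢ G d-a))
                                 (≢-sym (Adj⇒≢ G d-b)) c-x

  diamond-entry : ∀ {i} → Diamond i → ∀ {y} → f y ≡ i → Entry i y
  diamond-entry D {y} fy≡i with Diamond.cover D y fy≡i
  ... | inj₁ (inj₁ refl) = tip-entry D
  ... | inj₁ (inj₂ refl) = tip-entry (swap-tips D)
  ... | inj₂ (inj₁ refl) = centre-entry D
  ... | inj₂ (inj₂ refl) = centre-entry (swap-centres D)

  InducesDiamond⇒Diamond : ∀ {i} → InducesDiamond G (part G f i) → Diamond i
  InducesDiamond⇒Diamond {i} (∣P∣≡4 , a , b , a∈ , b∈ , a≢b , _ , only-ab)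
    with c , c∈P , c≢a ∷ c≢b ∷ [] ←
           length<∣p∣⇒fresh (part G f i) (a ∷ b ∷ []) (subst (2 <_) (sym ∣P∣≡4) (s<s (s<s z<s)))
    with d , d∈P , d≢a ∷ d≢b ∷ d≢c ∷ [] ←
           length<∣p∣⇒fresh (part G f i) (a ∷ b ∷ c ∷ [])
                            (subst (3 <_) (sym ∣P∣≡4) (s<s (s<s (s<s z<s))))
    = record
      { a = a ; b = b ; c = c ; d = d
      ; f-a = ∈-part⁻ a∈P ; f-b = ∈-part⁻ b∈P ; f-c = ∈-part⁻ c∈P ; f-d = ∈-part⁻ d∈P
      ; a≢b = a≢b
      ; c-a = adjacent c∈P a∈P c≢a c≢b c≢a ; c-b = adjacent c∈P b∈P c≢a c≢b c≢b
      ; d-a = adjacent d∈P a∈P d≢a d≢b d≢a ; d-b = adjacent d∈P b∈P d≢a d≢b d≢b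
      ; c-d = adjacent c∈P d∈P c≢a c≢b (≢-sym d≢c)
      ; cover = cover }
    where
    a∈P = lookup⇒[]= a _ a∈
    b∈P = lookup⇒[]= b _ b∈
    adjacent : ∀ {u v} → u ∈ part G f i → v ∈ part G f i → u ≢ a → u ≢ b → u ≢ v → Adj G u v
    adjacent {u} {v} u∈P v∈P u≢a u≢b u≢v with adj G u v in u-v
    ... | true  = refl
    ... | false with only-ab u v ([]=⇒lookup u∈P) ([]=⇒lookup v∈P) u≢v u-v
    ...   | inj₁ (u≡a , _) = ⊥-elim (u≢a u≡a)
    ...   | inj₂ (u≡b , _) = ⊥-elim (u≢b u≡b)
    abcd! : Unique (a ∷ b ∷ c ∷ d ∷ [])
    abcd! = (a≢b ∷ ≢-sym c≢a ∷ ≢-sym d≢a ∷ []) ∷ (≢-sym c≢b ∷ ≢-sym d≢b ∷ [])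
          ∷ (≢-sym d≢c ∷ []) ∷ [] ∷ []
    cover : ∀ v → f v ≡ i → (v ≡ a ⊎ v ≡ b) ⊎ (v ≡ c ⊎ v ≡ d)
    cover v fv≡i
      with ∣p∣≤length⇒∈ abcd! (a∈P ∷ b∈P ∷ c∈P ∷ d∈P ∷ []) (≤-reflexive ∣P∣≡4) (∈-part⁺ fv≡i)
    ... | here refl                         = inj₁ (inj₁ refl)
    ... | there (here refl)                 = inj₁ (inj₂ refl)
    ... | there (there (here refl))         = inj₂ (inj₁ refl)
    ... | there (there (there (here refl))) = inj₂ (inj₂ refl)

module Partition {n : ℕ} (G : Graph n) (cubic : Cubic G) {k : ℕ} (f : Fin n → Fin k)
                 (t : Fin k → UnitKind) (partition : IsUnitPartition G f t) where

  open Units G cubic f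

  entry : ∀ y → Entry (f y) y
  entry y with t (f y) | partition (f y)
  ... | triangle | P-triangle = triangle-entry P-triangle refl
  ... | diamond  | P-diamond  = diamond-entry (InducesDiamond⇒Diamond P-diamond) refl

  representative : ∀ i → ∃ λ v → f v ≡ i
  representative i with t i | partition i
  ... | triangle | ∣P∣≡3 , _
    with v , v∈P , [] ← length<∣p∣⇒fresh (part G f i) [] (subst (0 <_) (sym ∣P∣≡3) z<s)
    = v , ∈-part⁻ v∈P
  ... | diamond  | _ , a , _ , a∈P , _ = a , ∈-part⁻ (lookup⇒[]= a _ a∈P)

  unit-vertices : Fin k → List (Fin n)
  unit-vertices i = v ∷ e₁ ∷ e₂ ∷ []
    where
    v = proj₁ (representative i)
    open Entry (entry v)

  unit-vertices-unique : ∀ i → Unique (unit-vertices i)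
  unit-vertices-unique i = (Adj⇒≢ G y-e₁ ∷ Adj⇒≢ G y-e₂ ∷ []) ∷ (e₁≢e₂ ∷ []) ∷ [] ∷ []
    where open Entry (entry (proj₁ (representative i)))

  unit-vertices-in-unit : ∀ i → All (λ v → f v ≡ i) (unit-vertices i)
  unit-vertices-in-unit i = fv≡i ∷ trans f-e₁ fv≡i ∷ trans f-e₂ fv≡i ∷ []
    where
    v = proj₁ (representative i)
    fv≡i = proj₂ (representative i)
    open Entry (entry v)

  3k≤n : 3 * k ≤ n
  3k≤n = subst (_≤ n) (*-comm k 3) (fibres⇒*≤ f (λ i → List.lookup (unit-vertices i))
           (λ i j → All.lookup (unit-vertices-in-unit i) (∈-lookup j))
           (λ i → lookup-injective (unit-vertices-unique i)))

  record Stage : Set where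
    field
      done      : List (Fin k)
      done!     : Unique done
      S         : Subset n
      coloured  : ∀ v → f v ∈ˡ done → Coloured G S v
      ∣S∣≤      : ∣ S ∣ ≤ length done + 2
      root      : Fin n
      root-done : f root ∈ˡ done

  initial : Fin n → Stage
  initial v = record
    { done = f v ∷ [] ; done! = [] ∷ [] ; S = S₀ ; coloured = coloured₀ ; ∣S∣≤ = ∣S₀∣≤3
    ; root = v ; root-done = here refl }
    where
    open Entry (entry v)
    S₀ = ⁅ v ⁆ ∪ ⁅ e₁ ⁆ ∪ ⁅ e₂ ⁆
    ∣S₀∣≤3 : ∣ S₀ ∣ ≤ 3
    ∣S₀∣≤3 = ≤-trans (∣⁅x⁆∪p∣≤1+∣p∣ v _)
               (s≤s (≤-trans (∣⁅x⁆∪p∣≤1+∣p∣ e₁ _) (s≤s (≤-reflexive (∣⁅x⁆∣≡1 e₂)))))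
    coloured₀ : ∀ w → f w ∈ˡ f v ∷ [] → Coloured G S₀ w
    coloured₀ w (here fw≡fv) =
      seed (colour G (p⊆p∪q _ (x∈⁅x⁆ v)))
           (colour G (q⊆p∪q ⁅ v ⁆ _ (p⊆p∪q _ (x∈⁅x⁆ e₁))))
           (colour G (q⊆p∪q ⁅ v ⁆ _ (q⊆p∪q ⁅ e₁ ⁆ _ (x∈⁅x⁆ e₂))))
           w fw≡fv

  grow : (st : Stage) → ∀ {x y} → Adj G x y →
         f x ∈ˡ Stage.done st → ¬ f y ∈ˡ Stage.done st → Stage
  grow st {x} {y} x-y fx-done fy-new = record
    { done = f y ∷ done ; done! = ¬Any⇒All¬ done fy-new ∷ done!
    ; S = S′ ; coloured = coloured′ ; ∣S∣≤ = ≤-trans (∣⁅x⁆∪p∣≤1+∣p∣ Y.e₁ S) (s≤s ∣S∣≤)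
    ; root = root ; root-done = there root-done }
    where
    open Stage st
    module X = Entry (entry x)
    module Y = Entry (entry y)
    S′ = ⁅ Y.e₁ ⁆ ∪ S
    old : ∀ {v} → f v ∈ˡ done → Coloured G S′ v
    old fv-done = Coloured-mono G (q⊆p∪q ⁅ Y.e₁ ⁆ S) (coloured _ fv-done)
    fy≢fx : f y ≢ f x
    fy≢fx fy≡fx = fy-new (subst (_∈ˡ done) (sym fy≡fx) fx-done)
    Cy : Coloured G S′ y
    Cy = force-third G cubic X.y-e₁ X.y-e₂ x-y X.e₁≢e₂
           (≢-across-units X.f-e₁ fy≢fx) (≢-across-units X.f-e₂ fy≢fx) (old fx-done)
           (old (subst (_∈ˡ done) (sym X.f-e₁) fx-done))
           (old (subst (_∈ˡ done) (sym X.f-e₂) fx-done))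
    coloured′ : ∀ v → f v ∈ˡ f y ∷ done → Coloured G S′ v
    coloured′ v (here fv≡fy)    = Y.enter (Adj-sym G x-y) (≢-sym fy≢fx) (old fx-done) Cy
                                    (colour G (p⊆p∪q S (x∈⁅x⁆ Y.e₁))) v fv≡fy
    coloured′ v (there fv-done) = old fv-done

  finish : (st : Stage) → k ≤ length (Stage.done st) → ZeroForcingNumber≤ G (k + 2)
  finish st k≤len = S , (λ v → coloured v (all-done (f v))) , ≤-trans ∣S∣≤ (+-monoˡ-≤ 2 len≤k)
    where
    open Stage st
    done⊆⊤ : All (_∈ ⊤) done
    done⊆⊤ = All.tabulate (λ _ → ∈⊤)
    len≤k : length done ≤ k
    len≤k = subst (length done ≤_) (∣⊤∣≡n k) (Unique⇒length≤∣p∣ done! done⊆⊤)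
    all-done : ∀ i → i ∈ˡ done
    all-done i = ∣p∣≤length⇒∈ done! done⊆⊤ (subst (_≤ length done) (sym (∣⊤∣≡n k)) k≤len) ∈⊤

  module _ (connected : Connected G) where

    leaving-edge : (st : Stage) → length (Stage.done st) < k →
                   ∃₂ λ x y → Adj G x y × f x ∈ˡ Stage.done st × ¬ f y ∈ˡ Stage.done st
    leaving-edge st len<k
      with i , _ , i-new ← length<∣p∣⇒fresh ⊤ (Stage.done st)
                             (subst (length (Stage.done st) <_) (sym (∣⊤∣≡n k)) len<k)
      with v , refl ← representative i
      = crossing-edge G (λ w → any? (f w ≟_) (Stage.done st))
                      (connected (Stage.root st) v) (Stage.root-done st) (All¬⇒¬Any i-new)

    complete : ∀ m (st : Stage) → k ≤ length (Stage.done st) + m → ZeroForcingNumber≤ G (k + 2)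
    complete zero    st k≤len+0 = finish st (subst (k ≤_) (+-identityʳ _) k≤len+0)
    complete (suc m) st k≤len+m+1 with k ≤? length (Stage.done st)
    ... | yes k≤len = finish st k≤len
    ... | no  k≰len with x , y , x-y , fx-done , fy-new ← leaving-edge st (≰⇒> k≰len)
      = complete m (grow st x-y fx-done fy-new) (subst (k ≤_) (+-suc _ m) k≤len+m+1)

    zero-forcing : Fin n → ZeroForcingNumber≤ G (k + 2)
    zero-forcing v = complete k (initial v) (n≤1+n k)

n₃+n₄≡k : ∀ {k} (t : Fin k → UnitKind) → n₃ t + n₄ t ≡ k
n₃+n₄≡k {zero}  t = refl
n₃+n₄≡k {suc k} t with t zero | n₃+n₄≡k (t ∘ suc)
... | triangle | ih = cong suc ih
... | diamond  | ih = trans (+-suc _ _) (cong suc ih)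

corollary5p1 : (n : ℕ) (G : Graph n) → ¬ IsK4 G → Connected G → ClawFree G → Cubic G →
    (k : ℕ) (f : Fin n → Fin k) (t : Fin k → UnitKind) → IsUnitPartition G f t →
    ZeroForcingNumber≤ G (n₃ t + n₄ t + 2) × (∃[ S ] (ZeroForcingSet G S × 3 * ∣ S ∣ ≤ n + 6))
-- The unit partition is a hypothesis.
corollary5p1 zero    G _ _         _ _     k f t partition = ([] , (λ ()) , z≤n) , ([] , (λ ()) , z≤n)
corollary5p1 (suc n) G _ connected _ cubic k f t partition
  with S , forcing , ∣S∣≤k+2 ← Partition.zero-forcing G cubic f t partition connected zero
  = (S , forcing , subst (λ m → ∣ S ∣ ≤ m + 2) (sym (n₃+n₄≡k t)) ∣S∣≤k+2) , (S , forcing , 3∣S∣≤n+6)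
  where
  open Partition G cubic f t partition
  3∣S∣≤n+6 : 3 * ∣ S ∣ ≤ suc n + 6
  3∣S∣≤n+6 = begin
    3 * ∣ S ∣    ≤⟨ *-monoʳ-≤ 3 ∣S∣≤k+2 ⟩
    3 * (k + 2)  ≡⟨ *-distribˡ-+ 3 k 2 ⟩
    3 * k + 6    ≤⟨ +-monoˡ-≤ 6 3k≤n ⟩
    suc n + 6    ∎
    where open ≤-Reasoning
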